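{- For every prime $p\geq 3$ and every $t\in\mathbb{F}_p$: if $t\neq 1$ then ${_{p-1}G_{p-1}}(t)=0$, and ${_{p-1}G_{p-1}}(1)=-1$.
   Context: $\Gamma_p$ is Morita's $p$-adic gamma function; $\omega$ is the Teichmüller character of $\mathbb{F}_p^\times$ ($\omega(a)\equiv a\pmod p$), $\overline{\omega}$ its inverse, and every multiplicative character (including the trivial one) takes value $0$ at $0$. $\langle x\rangle$ denotes the fractional part and $\lfloor x\rfloor$ the floor of $x\in\mathbb{Q}$. For $a_k,b_k\in\mathbb{Q}\cap\mathbb{Z}_p$ and $t\in\mathbb{F}_p$, $${_n\mathbb{G}_n}\left[\begin{array}{ccc}a_1,&\ldots,&a_n\\ b_1,&\ldots,&b_n\end{array}\Big| t\right]:=\frac{ -1}{p-1}\sum_{a=0}^{p-2}(-1)^{an}\,\overline{\omega}^a(t)\prod_{k=1}^n(-p)^{ -\lfloor\langle a_k\rangle-\frac{a}{p-1}\rfloor-\lfloor\langle -b_k\rangle+\frac{a}{p-1}\rfloor}\frac{\Gamma_p(\langle a_k-\frac{a}{p-1}\rangle)}{\Gamma_p(\langle a_k\rangle)}\frac{\Gamma_p(\langle -b_k+\frac{a}{p-1}\rangle)}{\Gamma_p(\langle -b_k\rangle)},$$ and ${_nG_n}(t):={_n\mathbb{G}_n}\left[\begin{array}{cccc}\frac{1}{2n},&\frac{3}{2n},&\ldots,&\frac{2n-1}{2n}\\ 0,&\frac1n,&\ldots,&\frac{n-1}{n}\end{array}\Big| t\right]$; the claim concerns $n=p-1$. -}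

module Defs where

open import Data.Nat as ℕ using (ℕ; zero; suc; _∸_)
open import Data.Nat.Divisibility as ℕD using (_∣?_)
open import Data.Integer as ℤ using (ℤ; +_; -[1+_]; _%ℕ_; ∣_∣)
open import Data.Integer.Divisibility as ℤD using ()
open import Data.Rational as ℚ using (ℚ; ↥_; ↧_; floor)
open import Data.Fin as Fin using (Fin; toℕ)
open import Data.Vec as Vec using (Vec; []; tabulate; zipWith)
open import Data.List as List using (List; upTo; map; foldr)
open import Relation.Nullary using (yes; no)

-- Elements of ℚ_p are represented through their reductions modulo p^K.
-- A value x ∈ ℚ_p with p^s·x ∈ ℤ_p is given by the shift s and, for
-- each K, an integer approx K ≡ p^s·x (mod p^K).

record Qp (p : ℕ) : Set where
  constructor qp
  field
    shift  : ℕ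
    approx : ℕ → ℤ
open Qp public

_≈ₚ_ : {p : ℕ} → Qp p → Qp p → Set
_≈ₚ_ {p} x y = (K : ℕ) →
  (+ (p ℕ.^ K)) ℤD.∣ ((+ (p ℕ.^ shift y)) ℤ.* approx x K ℤ.- (+ (p ℕ.^ shift x)) ℤ.* approx y K)

constQp : {p : ℕ} → ℤ → Qp p
constQp c = qp 0 (λ _ → c)

-- least nonnegative residue of x modulo M (M = 0 is junk)
modℕ : ℕ → ℤ → ℕ
modℕ zero    x = 0
modℕ (suc M) x = x %ℕ suc M

-- inverse of a p-adic unit u modulo p^K (Euler: u^(φ(p^K)-1))
invMod : ℕ → ℕ → ℤ → ℤ
invMod p K u = u ℤ.^ ((p ∸ 1) ℕ.* p ℕ.^ (K ∸ 1) ∸ 1)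

Γnat : ℕ → ℕ → ℤ
Γnat p zero = + 1
Γnat p (suc n) with p ∣? n
... | yes _ = ℤ.- Γnat p n
... | no  _ = ℤ.- ((+ n) ℤ.* Γnat p n)

-- Γ_p(x) modulo p^K for x ∈ ℚ ∩ ℤ_p: Γ_p is the continuous extension of Γnat,
-- and |Γ_p(x) - Γ_p(y)| ≤ |x - y| (p odd), so Γ_p(x) ≡ Γ_p(m) (mod p^K) for
-- any natural m ≡ x (mod p^K).
Γp : (p K : ℕ) → ℚ → ℤ
Γp p K x = Γnat p (modℕ (p ℕ.^ K) ((↥ x) ℤ.* invMod p K (↧ x)))

-- Teichmüller character modulo p^K: ω(t) ≡ t^(p^(K-1)) (mod p^K);
-- ω̄^a(t) = ω(t)^(-a), and every character vanishes at 0.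

ωMod : (p K : ℕ) → ℕ → ℤ
ωMod p K t = (+ t) ℤ.^ (p ℕ.^ (K ∸ 1))

ωbarPow : (p K : ℕ) → Fin p → ℕ → ℤ
ωbarPow p K t a with toℕ t
... | zero  = + 0
... | suc _ = (invMod p K (ωMod p K (toℕ t))) ℤ.^ a

frac : ℚ → ℚ
frac x = x ℚ.- (floor x ℚ./ 1)

-- a / d as a rational (d = 0 is junk)
ratio : ℕ → ℕ → ℚ
ratio a zero    = ℚ.0ℚ
ratio a (suc d) = (+ a) ℚ./ suc d

sumℤ : List ℤ → ℤ
sumℤ = foldr ℤ._+_ (+ 0)

prodℤ : List ℤ → ℤ
prodℤ = foldr ℤ._*_ (+ 1)

-- p times the k-th factor of the a-th summand, modulo p^K:
-- p·(-p)^e · Γ_p(⟨α - s⟩)/Γ_p(⟨α⟩) · Γ_p(⟨-β + s⟩)/Γ_p(⟨-β⟩),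
-- with s = a/(p-1) and e = -⌊⟨α⟩ - s⌋ - ⌊⟨-β⟩ + s⌋ ≥ -1.
factor : (p K a : ℕ) → ℚ → ℚ → ℤ
factor p K a α β =
  ((ℤ.- (+ 1)) ℤ.^ ∣ e ∣) ℤ.* ((+ p) ℤ.^ ∣ (+ 1) ℤ.+ e ∣)
  ℤ.* (Γp p K (frac (α ℚ.- s)) ℤ.* invMod p K (Γp p K (frac α)))
  ℤ.* (Γp p K (frac ((ℚ.- β) ℚ.+ s)) ℤ.* invMod p K (Γp p K (frac (ℚ.- β))))
  where
    s : ℚ
    s = ratio a (p ∸ 1)
    e : ℤ
    e = ℤ.- floor (frac α ℚ.- s) ℤ.- floor (frac (ℚ.- β) ℚ.+ s)

-- p^n · nGn[a_1..a_n; b_1..b_n | t] modulo p^K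
nGnScaled : (p n : ℕ) → Vec ℚ n → Vec ℚ n → Fin p → ℕ → ℤ
nGnScaled p n as bs t K =
  ℤ.- invMod p K (+ (p ∸ 1)) ℤ.*
  sumℤ (map (λ a → ((ℤ.- (+ 1)) ℤ.^ (a ℕ.* n)) ℤ.* ωbarPow p K t a
                    ℤ.* prodℤ (Vec.toList (zipWith (factor p K a) as bs)))
            (upTo (p ∸ 1)))

nGn : (p n : ℕ) → Vec ℚ n → Vec ℚ n → Fin p → Qp p
nGn p n as bs t = qp n (nGnScaled p n as bs t)

aParams : (n : ℕ) → Vec ℚ n
aParams zero    = []
aParams (suc m) = tabulate (λ i → (+ (1 ℕ.+ 2 ℕ.* toℕ i)) ℚ./ (2 ℕ.* suc m))

bParams : (n : ℕ) → Vec ℚ n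
bParams zero    = []
bParams (suc m) = tabulate (λ i → (+ toℕ i) ℚ./ suc m)

nG : (p n : ℕ) → Fin p → Qp p
nG p n t = nGn p n (aParams n) (bParams n) t

-- Fix a < p − 1 and s = a/(p − 1). Modulo 1, subtracting s permutes the parameters
-- (2k+1)/(2(p−1)) and adding s permutes the −k/(p−1), so the Γ_p-quotients of the a-th
-- summand multiply to 1. The floors give the exponent 1 at k = 0 and −1 at k = a (if a ≠ 0)
-- and 0 elsewhere, so the powers of −p cancel and, p being odd, the a-th summand is ω̄^a(t).
-- Orthogonality of the characters ω̄^a then gives −(p−1)⁻¹ ∑ₐ ω̄^a(t) = −[t = 1].
-- All of this is checked modulo every p^K; units modulo p^K are inverted through Euler's
-- theorem, obtained from Fermat's little theorem by lifting the exponent.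

module Submission where

open import Defs
open import Data.Nat using (ℕ; _≤_; _∸_)
open import Data.Nat.Primality using (Prime)
open import Data.Integer using (+_; -_)
open import Data.Fin using (Fin; toℕ)
open import Data.Product using (_×_)
open import Relation.Binary.PropositionalEquality using (_≡_; _≢_)

open import Data.Nat as ℕ using (zero; suc; _<_; s≤s; z≤n)
import Data.Nat.Properties as ℕ
import Data.Nat.Divisibility as ℕ
import Data.Nat.DivMod as ℕ
import Data.Nat.GCD as ℕ
open import Data.Nat.Primality using (euclidsLemma; prime⇒nonTrivial; prime⇒irreducible)
open import Data.Nat.Combinatorics
  using (_C_; k>n⇒nCk≡0; nCk+nC[k+1]≡[n+1]C[k+1]; nCk≡n!/k![n-k]!; k![n∸k]!∣n!; nCn≡1)
open import Data.Integer as ℤ using (ℤ; _+_; _*_; _-_; _^_; 0ℤ; 1ℤ; -1ℤ; ∣_∣)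
import Data.Integer.Properties as ℤ
import Data.Integer.DivMod as ℤ
open import Data.Integer.Divisibility.Signed
  using (_∣_; divides; ∣ᵤ⇒∣; ∣⇒∣ᵤ; ∣-refl; ∣-trans; ∣m∣n⇒∣m+n; ∣m⇒∣-m; ∣n⇒∣m*n; ∣m⇒∣m*n; module ∣-Reasoning)
open import Data.Integer.Tactic.RingSolver using (solve-∀)
open import Data.Rational as ℚ using (ℚ; _/_; ↥_; ↧_; ↧ₙ_; floor)
import Data.Rational.Properties as ℚ
import Data.Rational.Unnormalised as ℚᵘ
import Data.Rational.Unnormalised.Properties as ℚᵘ
open import Data.Fin using (zero; suc)
import Data.Fin.Properties as Fin
import Data.List as List
import Data.Vec as Vec
open import Data.Product using (Σ; _,_)
open import Data.Sum using (_⊎_; inj₁; inj₂)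
open import Data.Empty using (⊥-elim)
open import Function using (_∘_; _$_; case_of_)
open import Level using (0ℓ)
open import Relation.Binary.Bundles using (Setoid)
open import Relation.Binary.Definitions using (tri<; tri≈; tri>)
open import Relation.Binary.PropositionalEquality
  using (refl; sym; trans; cong; cong₂; subst; subst₂; module ≡-Reasoning)
open import Relation.Nullary using (¬_; yes; no)

-- Congruences on ℤ

infix 4 _≡_mod_
record _≡_mod_ (x y : ℤ) (M : ℕ) : Set where
  constructor ∣⇒≡-mod
  field ≡-mod⇒∣ : + M ∣ x - y
open _≡_mod_

module _ {M : ℕ} where
  open ∣-Reasoning

  ≡⇒≡-mod : ∀ {x y} → x ≡ y → x ≡ y mod M
  ≡⇒≡-mod {x} refl = ∣⇒≡-mod (divides 0ℤ (ℤ.+-inverseʳ x))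

  ≡-mod-sym : ∀ {x y} → x ≡ y mod M → y ≡ x mod M
  ≡-mod-sym {x} {y} (∣⇒≡-mod x≡y) = ∣⇒≡-mod $ begin
    + M          ∣⟨ ∣m⇒∣-m x≡y ⟩
    - (x - y)    ≡⟨ identity x y ⟩
    y - x        ∎
    where identity : ∀ x y → - (x - y) ≡ y - x
          identity = solve-∀

  ≡-mod-trans : ∀ {x y z} → x ≡ y mod M → y ≡ z mod M → x ≡ z mod M
  ≡-mod-trans {x} {y} {z} (∣⇒≡-mod x≡y) (∣⇒≡-mod y≡z) = ∣⇒≡-mod $ begin
    + M                 ∣⟨ ∣m∣n⇒∣m+n x≡y y≡z ⟩
    (x - y) + (y - z)   ≡⟨ identity x y z ⟩
    x - z               ∎
    where identity : ∀ x y z → (x - y) + (y - z) ≡ x - z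
          identity = solve-∀

  +-cong-mod : ∀ {x x′ y y′} → x ≡ x′ mod M → y ≡ y′ mod M → x + y ≡ x′ + y′ mod M
  +-cong-mod {x} {x′} {y} {y′} (∣⇒≡-mod x≡x′) (∣⇒≡-mod y≡y′) = ∣⇒≡-mod $ begin
    + M                     ∣⟨ ∣m∣n⇒∣m+n x≡x′ y≡y′ ⟩
    (x - x′) + (y - y′)     ≡⟨ identity x x′ y y′ ⟩
    (x + y) - (x′ + y′)     ∎
    where identity : ∀ x x′ y y′ → (x - x′) + (y - y′) ≡ (x + y) - (x′ + y′)
          identity = solve-∀

  *-cong-mod : ∀ {x x′ y y′} → x ≡ x′ mod M → y ≡ y′ mod M → x * y ≡ x′ * y′ mod M
  *-cong-mod {x} {x′} {y} {y′} (∣⇒≡-mod x≡x′) (∣⇒≡-mod y≡y′) = ∣⇒≡-mod $ begin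
    + M                             ∣⟨ ∣m∣n⇒∣m+n (∣m⇒∣m*n y x≡x′) (∣n⇒∣m*n x′ y≡y′) ⟩
    (x - x′) * y + x′ * (y - y′)    ≡⟨ identity x x′ y y′ ⟩
    x * y - x′ * y′                 ∎
    where identity : ∀ x x′ y y′ → (x - x′) * y + x′ * (y - y′) ≡ x * y - x′ * y′
          identity = solve-∀

  ≡-mod-setoid : Setoid 0ℓ 0ℓ
  ≡-mod-setoid = record
    { Carrier       = ℤ
    ; _≈_           = λ x y → x ≡ y mod M
    ; isEquivalence = record { refl = ≡⇒≡-mod refl ; sym = ≡-mod-sym ; trans = ≡-mod-trans }
    }

  -‿cong-mod : ∀ {x y} → x ≡ y mod M → - x ≡ - y mod M
  -‿cong-mod {x} {y} (∣⇒≡-mod x≡y) = ∣⇒≡-mod $ begin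
    + M          ∣⟨ ∣m⇒∣-m x≡y ⟩
    - (x - y)    ≡⟨ identity x y ⟩
    - x - - y    ∎
    where identity : ∀ x y → - (x - y) ≡ - x - - y
          identity = solve-∀

  ^-cong-mod : ∀ {x y} n → x ≡ y mod M → x ^ n ≡ y ^ n mod M
  ^-cong-mod zero    x≡y = ≡⇒≡-mod refl
  ^-cong-mod (suc n) x≡y = *-cong-mod x≡y (^-cong-mod n x≡y)

  +-congˡ-mod : ∀ z {x y} → x ≡ y mod M → z + x ≡ z + y mod M
  +-congˡ-mod z = +-cong-mod (≡⇒≡-mod {z} refl)

  *-congˡ-mod : ∀ z {x y} → x ≡ y mod M → z * x ≡ z * y mod M
  *-congˡ-mod z = *-cong-mod (≡⇒≡-mod {z} refl)

  *-congʳ-mod : ∀ z {x y} → x ≡ y mod M → x * z ≡ y * z mod M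
  *-congʳ-mod z x≡y = *-cong-mod x≡y (≡⇒≡-mod {z} refl)

module ≡-mod-Reasoning (M : ℕ) where
  open import Relation.Binary.Reasoning.Setoid (≡-mod-setoid {M}) public

∣⇒≡0-mod : ∀ {M x} → + M ∣ x → x ≡ 0ℤ mod M
∣⇒≡0-mod {x = x} M∣x = ∣⇒≡-mod (subst (_ ∣_) (sym (ℤ.+-identityʳ x)) M∣x)

≡0-mod⇒∣ : ∀ {M x} → x ≡ 0ℤ mod M → + M ∣ x
≡0-mod⇒∣ {x = x} (∣⇒≡-mod M∣x-0) = subst (_ ∣_) (ℤ.+-identityʳ x) M∣x-0

≡-mod-%ℕ : ∀ z M .{{_ : ℕ.NonZero M}} → z ≡ + (z ℤ.%ℕ M) mod M
≡-mod-%ℕ z M = ∣⇒≡-mod (divides (z ℤ./ℕ M) (begin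
  z - + r                     ≡⟨ cong (_- + r) (ℤ.a≡a%ℕn+[a/ℕn]*n z M) ⟩
  + r + z ℤ./ℕ M * + M - + r  ≡⟨ identity (+ r) (z ℤ./ℕ M * + M) ⟩
  z ℤ./ℕ M * + M              ∎))
  where
  open ≡-Reasoning
  r : ℕ
  r = z ℤ.%ℕ M
  identity : ∀ r s → r + s - r ≡ s
  identity = solve-∀

≡-mod-weaken : ∀ {M M′ x y} → M ℕ.∣ M′ → x ≡ y mod M′ → x ≡ y mod M
≡-mod-weaken M∣M′ (∣⇒≡-mod M′∣x-y) = ∣⇒≡-mod (∣-trans (∣ᵤ⇒∣ M∣M′) M′∣x-y)

*-pres-∣ : ∀ {M M′ x y} → + M ∣ x → + M′ ∣ y → + (M ℕ.* M′) ∣ x * y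
*-pres-∣ {M} {M′} {x} {y} M∣x M′∣y =
  ∣ᵤ⇒∣ (subst (M ℕ.* M′ ℕ.∣_) (sym (ℤ.abs-* x y)) (ℕ.*-pres-∣ (∣⇒∣ᵤ M∣x) (∣⇒∣ᵤ M′∣y)))

∣-neg⇒∣ : ∀ {m x} → m ∣ - x → m ∣ x
∣-neg⇒∣ {x = x} m∣-x = subst (_ ∣_) (ℤ.neg-involutive x) (∣m⇒∣-m m∣-x)

prime∣*⇒∣⊎∣ : ∀ {p x y} → Prime p → + p ∣ x * y → (+ p ∣ x) ⊎ (+ p ∣ y)
prime∣*⇒∣⊎∣ {p} {x} {y} p-prime p∣xy
  with euclidsLemma ∣ x ∣ ∣ y ∣ p-prime (subst (p ℕ.∣_) (ℤ.abs-* x y) (∣⇒∣ᵤ p∣xy))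
... | inj₁ p∣x = inj₁ (∣ᵤ⇒∣ p∣x)
... | inj₂ p∣y = inj₂ (∣ᵤ⇒∣ p∣y)

-- Finite sums and products

∑< ∏< : ℕ → (ℕ → ℤ) → ℤ
∑< zero    f = 0ℤ
∑< (suc n) f = f 0 + ∑< n (f ∘ suc)
∏< zero    f = 1ℤ
∏< (suc n) f = f 0 * ∏< n (f ∘ suc)

syntax ∑< n (λ k → e) = ∑[ k < n ] e
syntax ∏< n (λ k → e) = ∏[ k < n ] e

∑-cong : ∀ n {f g} → (∀ k → k < n → f k ≡ g k) → ∑< n f ≡ ∑< n g
∑-cong zero    f≡g = refl
∑-cong (suc n) f≡g = cong₂ _+_ (f≡g 0 ℕ.z<s) (∑-cong n (λ k → f≡g (suc k) ∘ s≤s))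

∏-cong : ∀ n {f g} → (∀ k → k < n → f k ≡ g k) → ∏< n f ≡ ∏< n g
∏-cong zero    f≡g = refl
∏-cong (suc n) f≡g = cong₂ _*_ (f≡g 0 ℕ.z<s) (∏-cong n (λ k → f≡g (suc k) ∘ s≤s))

∑-cong-mod : ∀ {M} n {f g} → (∀ k → k < n → f k ≡ g k mod M) → ∑< n f ≡ ∑< n g mod M
∑-cong-mod zero    f≡g = ≡⇒≡-mod refl
∑-cong-mod (suc n) f≡g = +-cong-mod (f≡g 0 ℕ.z<s) (∑-cong-mod n (λ k → f≡g (suc k) ∘ s≤s))

∏-cong-mod : ∀ {M} n {f g} → (∀ k → k < n → f k ≡ g k mod M) → ∏< n f ≡ ∏< n g mod M
∏-cong-mod zero    f≡g = ≡⇒≡-mod refl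
∏-cong-mod (suc n) f≡g = *-cong-mod (f≡g 0 ℕ.z<s) (∏-cong-mod n (λ k → f≡g (suc k) ∘ s≤s))

∑-distrib-+ : ∀ n {f g} → ∑[ k < n ] (f k + g k) ≡ ∑< n f + ∑< n g
∑-distrib-+ zero    {f} {g} = refl
∑-distrib-+ (suc n) {f} {g} = trans (cong (_+_ (f 0 + g 0)) (∑-distrib-+ n)) (identity (f 0) (g 0) _ _)
  where identity : ∀ a b c d → a + b + (c + d) ≡ a + c + (b + d)
        identity = solve-∀

∏-distrib-* : ∀ n {f g} → ∏[ k < n ] (f k * g k) ≡ ∏< n f * ∏< n g
∏-distrib-* zero    {f} {g} = refl
∏-distrib-* (suc n) {f} {g} = trans (cong ((f 0 * g 0) *_) (∏-distrib-* n)) (identity (f 0) (g 0) _ _)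
  where identity : ∀ a b c d → a * b * (c * d) ≡ a * c * (b * d)
        identity = solve-∀

∑-*ˡ : ∀ n c f → ∑[ k < n ] (c * f k) ≡ c * ∑< n f
∑-*ˡ zero    c f = sym (ℤ.*-zeroʳ c)
∑-*ˡ (suc n) c f = trans (cong (_+_ (c * f 0)) (∑-*ˡ n c (f ∘ suc))) (sym (ℤ.*-distribˡ-+ c (f 0) _))

∑-*ʳ : ∀ n c f → ∑[ k < n ] (f k * c) ≡ ∑< n f * c
∑-*ʳ n c f = trans (∑-cong n (λ k _ → ℤ.*-comm (f k) c)) (trans (∑-*ˡ n c f) (ℤ.*-comm c (∑< n f)))

∑-const : ∀ n c → ∑[ k < n ] c ≡ + n * c
∑-const zero    c = refl
∑-const (suc n) c = trans (cong (_+_ c) (∑-const n c)) (sym (ℤ.suc-* (+ n) c))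

∏-const : ∀ n c → ∏[ k < n ] c ≡ c ^ n
∏-const zero    c = refl
∏-const (suc n) c = cong (c *_) (∏-const n c)

∑-last : ∀ n f → ∑< (suc n) f ≡ ∑< n f + f n
∑-last zero    f = trans (ℤ.+-identityʳ (f 0)) (sym (ℤ.+-identityˡ (f 0)))
∑-last (suc n) f = trans (cong (_+_ (f 0)) (∑-last n (f ∘ suc))) (sym (ℤ.+-assoc (f 0) _ _))

∏-last : ∀ n f → ∏< (suc n) f ≡ ∏< n f * f n
∏-last zero    f = trans (ℤ.*-identityʳ (f 0)) (sym (ℤ.*-identityˡ (f 0)))
∏-last (suc n) f = trans (cong (f 0 *_) (∏-last n (f ∘ suc))) (sym (ℤ.*-assoc (f 0) _ _))

geometric-sum : ∀ n w → (w - 1ℤ) * (∑[ a < n ] (w ^ a)) ≡ w ^ n - 1ℤ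
geometric-sum zero    w = ℤ.*-zeroʳ (w - 1ℤ)
geometric-sum (suc n) w = begin
  (w - 1ℤ) * (1ℤ + ∑[ a < n ] (w * w ^ a))   ≡⟨ cong (λ s → (w - 1ℤ) * (1ℤ + s)) (∑-*ˡ n w (w ^_)) ⟩
  (w - 1ℤ) * (1ℤ + w * S)                     ≡⟨ identity₁ w S ⟩
  w - 1ℤ + w * ((w - 1ℤ) * S)                 ≡⟨ cong (λ s → w - 1ℤ + w * s) (geometric-sum n w) ⟩
  w - 1ℤ + w * (w ^ n - 1ℤ)                   ≡⟨ identity₂ w (w ^ n) ⟩
  w * w ^ n - 1ℤ                              ∎
  where
  open ≡-Reasoning
  S : ℤ
  S = ∑[ a < n ] (w ^ a)
  identity₁ : ∀ w S → (w - 1ℤ) * (1ℤ + w * S) ≡ w - 1ℤ + w * ((w - 1ℤ) * S)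
  identity₁ = solve-∀
  identity₂ : ∀ w x → w - 1ℤ + w * (x - 1ℤ) ≡ w * x - 1ℤ
  identity₂ = solve-∀

∏-single : ∀ n i (f : ℕ → ℤ) x y → i < n → f i ≡ x → (∀ k → k < n → k ≢ i → f k ≡ y) → ∏< n f ≡ x * y ^ (n ∸ 1)
∏-single (suc n) zero f x y _ fi≡x fk≡y =
  cong₂ _*_ fi≡x (trans (∏-cong n (λ k k<n → fk≡y (suc k) (s≤s k<n) λ ())) (∏-const n y))
∏-single (suc (suc n)) (suc i) f x y (s≤s i<n) fi≡x fk≡y =
  trans (cong₂ _*_ (fk≡y 0 ℕ.z<s λ ()) (∏-single (suc n) i (f ∘ suc) x y i<n fi≡x
                     (λ k k<n k≢i → fk≡y (suc k) (s≤s k<n) (k≢i ∘ ℕ.suc-injective))))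
        (identity x y (y ^ n))
  where identity : ∀ x y z → y * (x * z) ≡ x * (y * z)
        identity = solve-∀

∏-periodic-shift : ∀ n (g : ℤ → ℤ) z c → (∀ x → g (x + c * + suc n) ≡ g x) →
                   ∀ a → ∏[ k < suc n ] g (z + c * (+ k - + a)) ≡ ∏[ k < suc n ] g (z + c * + k)
∏-periodic-shift n g z c periodic zero =
  ∏-cong (suc n) (λ k _ → cong (λ y → g (z + c * y)) (ℤ.+-identityʳ (+ k)))
∏-periodic-shift n g z c periodic (suc a) = trans rotate (∏-periodic-shift n g z c periodic a)
  where
  open ≡-Reasoning
  h : ℕ → ℤ
  h k = g (z + c * (+ k - + a))
  rotate : ∏[ k < suc n ] g (z + c * (+ k - + suc a)) ≡ ∏< (suc n) h
  rotate = begin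
    g (z + c * (0ℤ - + suc a)) * ∏[ k < n ] g (z + c * (+ suc k - + suc a))
      ≡⟨ cong₂ _*_ (trans (sym (periodic _)) (cong g (identity₁ z c (+ n) (+ a))))
                   (∏-cong n (λ k _ → cong (λ y → g (z + c * y)) (identity₂ (+ k) (+ a)))) ⟩
    h n * ∏< n h   ≡⟨ ℤ.*-comm (h n) _ ⟩
    ∏< n h * h n   ≡⟨ ∏-last n h ⟨
    ∏< (suc n) h   ∎
    where
    identity₁ : ∀ z c n a → z + c * (0ℤ - (1ℤ + a)) + c * (1ℤ + n) ≡ z + c * (n - a)
    identity₁ = solve-∀
    identity₂ : ∀ k a → (1ℤ + k) - (1ℤ + a) ≡ k - a
    identity₂ = solve-∀

∏-ratio≡1 : ∀ {M} n (X Y : ℕ → ℤ) (inv : ℤ → ℤ) → ∏< n X ≡ ∏< n Y → (∀ k → k < n → Y k * inv (Y k) ≡ 1ℤ mod M) →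
            ∏[ k < n ] (X k * inv (Y k)) ≡ 1ℤ mod M
∏-ratio≡1 {M} n X Y inv ∏X≡∏Y YY⁻¹≡1 = begin
  ∏[ k < n ] (X k * inv (Y k))        ≡⟨ ∏-distrib-* n ⟩
  ∏< n X * ∏[ k < n ] inv (Y k)       ≡⟨ cong (_* ∏[ k < n ] inv (Y k)) ∏X≡∏Y ⟩
  ∏< n Y * ∏[ k < n ] inv (Y k)       ≡⟨ ∏-distrib-* n ⟨
  ∏[ k < n ] (Y k * inv (Y k))        ≈⟨ ∏-cong-mod n YY⁻¹≡1 ⟩
  ∏[ k < n ] 1ℤ                       ≡⟨ trans (∏-const n 1ℤ) (ℤ.^-zeroˡ n) ⟩
  1ℤ                                  ∎
  where open ≡-mod-Reasoning M

-- Fermat and Euler modulo prime powers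

binomial-theorem : ∀ n x → (1ℤ + x) ^ n ≡ ∑[ k < suc n ] (+ (n C k) * x ^ k)
binomial-theorem zero    x = refl
binomial-theorem (suc n) x = begin
  (1ℤ + x) * (1ℤ + x) ^ n                          ≡⟨ cong ((1ℤ + x) *_) (binomial-theorem n x) ⟩
  (1ℤ + x) * B                                     ≡⟨ identity x B ⟩
  B + 0ℤ + x * B                                   ≡⟨ cong (λ t → B + t + x * B) Tn[n+1]≡0 ⟨
  B + T n (suc n) + x * B                          ≡⟨ cong₂ _+_ (∑-last (suc n) (T n)) (∑-*ˡ (suc n) x (T n)) ⟨
  1ℤ + ∑[ k < suc n ] T n (suc k) + ∑[ k < suc n ] (x * T n k)
                                                   ≡⟨ ℤ.+-assoc 1ℤ (∑[ k < suc n ] T n (suc k)) _ ⟩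
  1ℤ + (∑[ k < suc n ] T n (suc k) + ∑[ k < suc n ] (x * T n k))
                                                   ≡⟨ cong (_+_ 1ℤ) (∑-distrib-+ (suc n) {T n ∘ suc} {λ k → x * T n k}) ⟨
  1ℤ + ∑[ k < suc n ] (T n (suc k) + x * T n k)    ≡⟨ cong (_+_ 1ℤ) (∑-cong (suc n) {g = T (suc n) ∘ suc} (λ k _ → pascal k)) ⟩
  1ℤ + ∑[ k < suc n ] T (suc n) (suc k)            ∎
  where
  open ≡-Reasoning
  -- n C 0 computes to 1, so T n 0 is definitionally 1ℤ.
  T : ℕ → ℕ → ℤ
  T n k = + (n C k) * x ^ k
  B : ℤ
  B = ∑[ k < suc n ] T n k
  identity : ∀ x B → (1ℤ + x) * B ≡ B + 0ℤ + x * B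
  identity = solve-∀
  Tn[n+1]≡0 : T n (suc n) ≡ 0ℤ
  Tn[n+1]≡0 = cong (λ c → + c * x ^ suc n) (k>n⇒nCk≡0 (ℕ.n<1+n n))
  pascal : ∀ k → T n (suc k) + x * T n k ≡ T (suc n) (suc k)
  pascal k = begin
    + (n C suc k) * x ^ suc k + x * (+ (n C k) * x ^ k)   ≡⟨ identity′ (+ (n C suc k)) (+ (n C k)) x (x ^ k) ⟩
    (+ (n C k) + + (n C suc k)) * x ^ suc k               ≡⟨ cong (λ c → c * x ^ suc k) (ℤ.pos-+ (n C k) (n C suc k)) ⟨
    + (n C k ℕ.+ n C suc k) * x ^ suc k                   ≡⟨ cong (λ c → + c * x ^ suc k) (nCk+nC[k+1]≡[n+1]C[k+1] n k) ⟩
    T (suc n) (suc k)                                     ∎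
    where identity′ : ∀ a b x y → a * (x * y) + x * (b * y) ≡ (b + a) * (x * y)
          identity′ = solve-∀

nCk*k!*[n∸k]!≡n! : ∀ {n k} → k ≤ n → (n C k) ℕ.* (k ℕ.! ℕ.* (n ∸ k) ℕ.!) ≡ n ℕ.!
nCk*k!*[n∸k]!≡n! {n} {k} k≤n = trans (cong (ℕ._* (k ℕ.! ℕ.* (n ∸ k) ℕ.!)) (nCk≡n!/k![n-k]! k≤n)) (ℕ.m/n*n≡m (k![n∸k]!∣n! k≤n))
  where
  instance
    k!*[n∸k]!≢0 : ℕ.NonZero (k ℕ.! ℕ.* (n ∸ k) ℕ.!)
    k!*[n∸k]!≢0 = ℕ._!*_!≢0 k (n ∸ k)

*-^-pred : ∀ x {n} → 0 < n → x * x ^ (n ∸ 1) ≡ x ^ n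
*-^-pred x {suc n} _ = refl

^-distribʳ-* : ∀ x y n → (x * y) ^ n ≡ x ^ n * y ^ n
^-distribʳ-* x y zero    = refl
^-distribʳ-* x y (suc n) = trans (cong ((x * y) *_) (^-distribʳ-* x y n)) (identity x y (x ^ n) (y ^ n))
  where identity : ∀ x y a b → x * y * (a * b) ≡ x * a * (y * b)
        identity = solve-∀

inverse-^≡1 : ∀ {M} u v n → u * v ≡ 1ℤ mod M → u ^ n ≡ 1ℤ mod M → v ^ n ≡ 1ℤ mod M
inverse-^≡1 {M} u v n uv≡1 uⁿ≡1 = begin
  v ^ n               ≡⟨ ℤ.*-identityˡ (v ^ n) ⟨
  1ℤ * v ^ n          ≈⟨ *-congʳ-mod (v ^ n) uⁿ≡1 ⟨
  u ^ n * v ^ n       ≡⟨ ^-distribʳ-* u v n ⟨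
  (u * v) ^ n         ≈⟨ ^-cong-mod n uv≡1 ⟩
  1ℤ ^ n              ≡⟨ ℤ.^-zeroˡ n ⟩
  1ℤ                  ∎
  where open ≡-mod-Reasoning M

inverse-≢1 : ∀ {M} u v → u * v ≡ 1ℤ mod M → ¬ u ≡ 1ℤ mod M → ¬ + M ∣ v - 1ℤ
inverse-≢1 {M} u v uv≡1 u≢1 M∣v-1 = u≢1 $ begin
  u          ≡⟨ ℤ.*-identityʳ u ⟨
  u * 1ℤ     ≈⟨ *-congˡ-mod u (∣⇒≡-mod M∣v-1) ⟨
  u * v      ≈⟨ uv≡1 ⟩
  1ℤ         ∎
  where open ≡-mod-Reasoning M

^-lift-≡1 : ∀ {M} n x → x ≡ 1ℤ mod M → n ℕ.∣ M → x ^ n ≡ 1ℤ mod (n ℕ.* M)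
^-lift-≡1 {M} n x x≡1 n∣M = ∣⇒≡-mod $ begin
  + (n ℕ.* M)                        ∣⟨ *-pres-∣ n∣∑ (≡-mod⇒∣ x≡1) ⟩
  (∑[ a < n ] (x ^ a)) * (x - 1ℤ)    ≡⟨ ℤ.*-comm _ (x - 1ℤ) ⟩
  (x - 1ℤ) * (∑[ a < n ] (x ^ a))    ≡⟨ geometric-sum n x ⟩
  x ^ n - 1ℤ                         ∎
  where
  open ∣-Reasoning
  ∑≡n : ∑[ a < n ] (x ^ a) ≡ + n mod n
  ∑≡n = ≡-mod-trans (∑-cong-mod n (λ a _ → ≡-mod-trans (^-cong-mod a (≡-mod-weaken n∣M x≡1)) (≡⇒≡-mod (ℤ.^-zeroˡ a))))
                    (≡⇒≡-mod (trans (∑-const n 1ℤ) (ℤ.*-identityʳ (+ n))))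
  n∣∑ : + n ∣ ∑[ a < n ] (x ^ a)
  n∣∑ = ≡0-mod⇒∣ (≡-mod-trans ∑≡n (∣⇒≡0-mod ∣-refl))

module _ {q : ℕ} (p-prime : Prime (suc q)) where
  private
    p : ℕ
    p = suc q

  prime∤! : ∀ m → m < p → ¬ p ℕ.∣ m ℕ.!
  prime∤! zero    _   p∣1 = ℕ.nonTrivial⇒≢1 {{prime⇒nonTrivial p-prime}} (ℕ.∣1⇒≡1 p∣1)
  prime∤! (suc m) m<p p∣m! with euclidsLemma (suc m) (m ℕ.!) p-prime p∣m!
  ... | inj₁ p∣1+m = ℕ.<⇒≱ m<p (ℕ.∣⇒≤ p∣1+m)
  ... | inj₂ p∣m!  = prime∤! m (ℕ.<-trans (ℕ.n<1+n m) m<p) p∣m!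

  prime∣pCk : ∀ k → 0 < k → k < p → p ℕ.∣ p C k
  prime∣pCk k 0<k k<p
    with euclidsLemma (p C k) _ p-prime (subst (p ℕ.∣_) (sym (nCk*k!*[n∸k]!≡n! (ℕ.<⇒≤ k<p))) (ℕ.m∣m*n (q ℕ.!)))
  ... | inj₁ p∣C = p∣C
  ... | inj₂ p∣k!*[p∸k]! with euclidsLemma (k ℕ.!) ((p ∸ k) ℕ.!) p-prime p∣k!*[p∸k]!
  ...   | inj₁ p∣k!     = ⊥-elim (prime∤! k k<p p∣k!)
  ...   | inj₂ p∣[p∸k]! = ⊥-elim (prime∤! (p ∸ k) (ℕ.∸-monoʳ-< 0<k (ℕ.<⇒≤ k<p)) p∣[p∸k]!)

  freshman's-dream : ∀ x → (1ℤ + x) ^ p ≡ 1ℤ + x ^ p mod p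
  freshman's-dream x = begin
    (1ℤ + x) ^ p                         ≡⟨ binomial-theorem p x ⟩
    1ℤ + ∑[ k < p ] T (suc k)            ≡⟨ cong (_+_ 1ℤ) (∑-last q (T ∘ suc)) ⟩
    1ℤ + (∑[ k < q ] T (suc k) + T p)    ≈⟨ +-congˡ-mod 1ℤ (+-cong-mod middle≡0 (≡⇒≡-mod Tp≡x^p)) ⟩
    1ℤ + (0ℤ + x ^ p)                    ≡⟨ cong (_+_ 1ℤ) (ℤ.+-identityˡ (x ^ p)) ⟩
    1ℤ + x ^ p                           ∎
    where
    open ≡-mod-Reasoning p
    T : ℕ → ℤ
    T k = + (p C k) * x ^ k
    Tp≡x^p : T p ≡ x ^ p
    Tp≡x^p = trans (cong (λ c → + c * x ^ p) (nCn≡1 p)) (ℤ.*-identityˡ (x ^ p))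
    middle≡0 : ∑[ k < q ] T (suc k) ≡ 0ℤ mod p
    middle≡0 = ≡-mod-trans
      (∑-cong-mod q (λ k k<q → ∣⇒≡0-mod (∣m⇒∣m*n {m = + (p C suc k)} (x ^ suc k) (∣ᵤ⇒∣ (prime∣pCk (suc k) ℕ.z<s (s≤s k<q))))))
      (≡⇒≡-mod (trans (∑-const q 0ℤ) (ℤ.*-zeroʳ (+ q))))

  fermat-ℕ : ∀ x → (+ x) ^ p ≡ + x mod p
  fermat-ℕ zero    = ≡⇒≡-mod refl
  fermat-ℕ (suc x) = ≡-mod-trans (freshman's-dream (+ x)) (+-congˡ-mod 1ℤ (fermat-ℕ x))

  fermat : ∀ x → x ^ p ≡ x mod p
  fermat x = begin
    x ^ p     ≈⟨ ^-cong-mod p (≡-mod-%ℕ x p) ⟩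
    (+ r) ^ p ≈⟨ fermat-ℕ r ⟩
    + r       ≈⟨ ≡-mod-%ℕ x p ⟨
    x         ∎
    where
    open ≡-mod-Reasoning p
    r : ℕ
    r = x ℤ.%ℕ p

  fermat-iterate : ∀ j x → x ^ (p ℕ.^ j) ≡ x mod p
  fermat-iterate zero    x = ≡⇒≡-mod (ℤ.^-identityʳ x)
  fermat-iterate (suc j) x = begin
    x ^ (p ℕ.* p ℕ.^ j)     ≡⟨ ℤ.^-*-assoc x p (p ℕ.^ j) ⟨
    (x ^ p) ^ (p ℕ.^ j)     ≈⟨ fermat-iterate j (x ^ p) ⟩
    x ^ p                   ≈⟨ fermat x ⟩
    x                       ∎
    where open ≡-mod-Reasoning p

  fermat-unit : ∀ {x} → ¬ + p ∣ x → x ^ q ≡ 1ℤ mod p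
  fermat-unit {x} p∤x with prime∣*⇒∣⊎∣ p-prime (subst (_ ∣_) (identity x (x ^ q)) (≡-mod⇒∣ (fermat x)))
    where identity : ∀ x y → x * y - x ≡ x * (y - 1ℤ)
          identity = solve-∀
  ... | inj₁ p∣x        = ⊥-elim (p∤x p∣x)
  ... | inj₂ p∣x^q-1    = ∣⇒≡-mod p∣x^q-1

  euler : ∀ {x} → ¬ + p ∣ x → ∀ j → x ^ (q ℕ.* p ℕ.^ j) ≡ 1ℤ mod (p ℕ.^ suc j)
  euler {x} p∤x zero    = subst₂ (λ e M → x ^ e ≡ 1ℤ mod M) (sym (ℕ.*-identityʳ q)) (sym (ℕ.*-identityʳ p)) (fermat-unit p∤x)
  euler {x} p∤x (suc j) = subst (λ e → x ^ e ≡ 1ℤ mod (p ℕ.^ suc (suc j))) exponent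
    (subst (λ y → y ≡ 1ℤ mod _) (ℤ.^-*-assoc x (q ℕ.* p ℕ.^ j) p) (^-lift-≡1 p _ (euler p∤x j) (ℕ.m∣m*n (p ℕ.^ j))))
    where exponent : q ℕ.* p ℕ.^ j ℕ.* p ≡ q ℕ.* p ℕ.^ suc j
          exponent = trans (ℕ.*-assoc q (p ℕ.^ j) p) (cong (q ℕ.*_) (ℕ.*-comm (p ℕ.^ j) p))

  invMod-inverse : ∀ {x} → ¬ + p ∣ x → ∀ j → x * invMod p (suc j) x ≡ 1ℤ mod (p ℕ.^ suc j)
  invMod-inverse {x} p∤x j = subst (λ y → y ≡ 1ℤ mod _) (sym (*-^-pred x 0<q*p^j)) (euler p∤x j)
    where 0<q*p^j : 0 < q ℕ.* p ℕ.^ j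
          0<q*p^j = ℕ.*-mono-≤ (ℕ.≤-pred (ℕ.nonTrivial⇒n>1 p {{prime⇒nonTrivial p-prime}})) (ℕ.m^n>0 p j)

  *-cancelˡ-≡0-mod : ∀ {u x} → ¬ + p ∣ u → ∀ j → u * x ≡ 0ℤ mod (p ℕ.^ suc j) → x ≡ 0ℤ mod (p ℕ.^ suc j)
  *-cancelˡ-≡0-mod {u} {x} p∤u j ux≡0 = begin
    x                        ≡⟨ ℤ.*-identityˡ x ⟨
    1ℤ * x                   ≈⟨ *-congʳ-mod x (invMod-inverse p∤u j) ⟨
    u * v * x                ≡⟨ identity u v x ⟩
    v * (u * x)              ≈⟨ *-congˡ-mod v ux≡0 ⟩
    v * 0ℤ                   ≡⟨ ℤ.*-zeroʳ v ⟩
    0ℤ                       ∎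
    where
    open ≡-mod-Reasoning (p ℕ.^ suc j)
    v : ℤ
    v = invMod p (suc j) u
    identity : ∀ u v x → u * v * x ≡ v * (u * x)
    identity = solve-∀

  geometric-sum≡0 : ∀ {w} n j → w ^ n ≡ 1ℤ mod (p ℕ.^ suc j) → ¬ + p ∣ w - 1ℤ →
                    ∑[ a < n ] (w ^ a) ≡ 0ℤ mod (p ℕ.^ suc j)
  geometric-sum≡0 {w} n j wⁿ≡1 p∤w-1 =
    *-cancelˡ-≡0-mod p∤w-1 j (∣⇒≡0-mod (subst (_ ∣_) (sym (geometric-sum n w)) (≡-mod⇒∣ wⁿ≡1)))

  ωMod^q≡1 : ∀ j {x} → ¬ p ℕ.∣ x → ωMod p (suc j) x ^ q ≡ 1ℤ mod (p ℕ.^ suc j)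
  ωMod^q≡1 j {x} p∤x = subst (λ y → y ≡ 1ℤ mod _)
    (trans (cong (_^_ (+ x)) (ℕ.*-comm q (p ℕ.^ j))) (sym (ℤ.^-*-assoc (+ x) (p ℕ.^ j) q)))
    (euler (p∤x ∘ ∣⇒∣ᵤ) j)

  ∑ωbar≡0 : ∀ j (t : Fin p) → toℕ t ≢ 1 → ∑[ a < q ] ωbarPow p (suc j) t a ≡ 0ℤ mod (p ℕ.^ suc j)
  ∑ωbar≡0 j zero             _   = ≡⇒≡-mod (trans (∑-const q 0ℤ) (ℤ.*-zeroʳ (+ q)))
  ∑ωbar≡0 j (suc zero)       t≢1 = ⊥-elim (t≢1 refl)
  ∑ωbar≡0 j (suc (suc r)) _   =
    geometric-sum≡0 {w} q j (inverse-^≡1 ω w q ωw≡1 (ωMod^q≡1 j p∤x)) (inverse-≢1 ω w (≡-mod-weaken (ℕ.m∣m*n (p ℕ.^ j)) ωw≡1) ω≢1)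
    where
    x : ℕ
    x = suc (suc (toℕ r))
    x<p : x < p
    x<p = s≤s (Fin.toℕ<n (suc r))
    p∤x : ¬ p ℕ.∣ x
    p∤x p∣x = ℕ.<⇒≱ x<p (ℕ.∣⇒≤ p∣x)
    ω w : ℤ
    ω = ωMod p (suc j) x
    w = invMod p (suc j) ω
    ω≡x : ω ≡ + x mod p
    ω≡x = fermat-iterate j (+ x)
    ωw≡1 : ω * w ≡ 1ℤ mod (p ℕ.^ suc j)
    ωw≡1 = invMod-inverse (λ p∣ω → p∤x (∣⇒∣ᵤ (≡0-mod⇒∣ (≡-mod-trans (≡-mod-sym ω≡x) (∣⇒≡0-mod p∣ω))))) j
    ω≢1 : ¬ ω ≡ 1ℤ mod p
    ω≢1 ω≡1 = ℕ.<⇒≱ (ℕ.m<n⇒m<1+n (Fin.toℕ<n (suc r))) (ℕ.∣⇒≤ (∣⇒∣ᵤ p∣x-1))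
      where p∣x-1 : + p ∣ + suc (toℕ r)
            p∣x-1 = subst (+ p ∣_) (identity (+ suc (toℕ r))) (≡-mod⇒∣ (≡-mod-trans (≡-mod-sym ω≡x) ω≡1))
              where identity : ∀ y → 1ℤ + y - 1ℤ ≡ y
                    identity = solve-∀

  ∑ωbar≡q : ∀ j (t : Fin p) → toℕ t ≡ 1 → ∑[ a < q ] ωbarPow p (suc j) t a ≡ + q
  ∑ωbar≡q j (suc zero) refl = trans (∑-cong q (λ a _ → ωbar[1]≡1 a)) (trans (∑-const q 1ℤ) (ℤ.*-identityʳ (+ q)))
    where
    ωbar[1]≡1 : ∀ a → invMod p (suc j) (ωMod p (suc j) 1) ^ a ≡ 1ℤ
    ωbar[1]≡1 a = trans (cong (_^ a) (trans (cong (invMod p (suc j)) (ℤ.^-zeroˡ (p ℕ.^ j))) (ℤ.^-zeroˡ (q ℕ.* p ℕ.^ j ∸ 1)))) (ℤ.^-zeroˡ a)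

  p∤Γnat : ∀ k → ¬ + p ∣ Γnat p k
  p∤Γnat zero    p∣1 = ℕ.nonTrivial⇒≢1 {{prime⇒nonTrivial p-prime}} (ℕ.∣1⇒≡1 (∣⇒∣ᵤ p∣1))
  p∤Γnat (suc k) with p ℕ.∣? k
  ... | yes _   = p∤Γnat k ∘ ∣-neg⇒∣
  ... | no  p∤k = λ p∣-kΓ → case prime∣*⇒∣⊎∣ {x = + k} p-prime (∣-neg⇒∣ p∣-kΓ) of λ where
    (inj₁ p∣k) → p∤k (∣⇒∣ᵤ p∣k)
    (inj₂ p∣Γ) → p∤Γnat k p∣Γ

-- Floors and fractional parts

/-cross : ∀ z w d e .{{_ : ℕ.NonZero d}} .{{_ : ℕ.NonZero e}} → z * + e ≡ w * + d → z / d ≡ w / e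
/-cross z w (suc d) (suc e) eq = ℚ.fromℚᵘ-cong {ℚᵘ.mkℚᵘ z d} {ℚᵘ.mkℚᵘ w e} (ℚᵘ.*≡* eq)

/-+-/ : ∀ z w d e .{{_ : ℕ.NonZero d}} .{{_ : ℕ.NonZero e}} →
        z / d ℚ.+ w / e ≡ ((z * + e + w * + d) / (d ℕ.* e)) {{ℕ.m*n≢0 d e}}
/-+-/ z w (suc d) (suc e) = ℚ.toℚᵘ-injective (ℚᵘ.≃-trans (ℚ.toℚᵘ-homo-+ (z / suc d) (w / suc e))
  (ℚᵘ.≃-trans (ℚᵘ.+-cong (ℚ.toℚᵘ-fromℚᵘ (ℚᵘ.mkℚᵘ z d)) (ℚ.toℚᵘ-fromℚᵘ (ℚᵘ.mkℚᵘ w e))) (ℚᵘ.≃-sym (ℚ.toℚᵘ-fromℚᵘ _))))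

-‿/ : ∀ z d .{{_ : ℕ.NonZero d}} → ℚ.- (z / d) ≡ (- z) / d
-‿/ z (suc d) = ℚ.toℚᵘ-injective (ℚᵘ.≃-trans (ℚ.toℚᵘ-homo‿- (z / suc d))
  (ℚᵘ.≃-trans (ℚᵘ.-‿cong (ℚ.toℚᵘ-fromℚᵘ (ℚᵘ.mkℚᵘ z d))) (ℚᵘ.≃-sym (ℚ.toℚᵘ-fromℚᵘ _))))

/-+-same : ∀ z w d .{{_ : ℕ.NonZero d}} → z / d ℚ.+ w / d ≡ (z + w) / d
/-+-same z w d = trans (/-+-/ z w d d) (/-cross (z * + d + w * + d) (z + w) (d ℕ.* d) d
  (trans (identity z w (+ d)) (cong ((z + w) *_) (sym (ℤ.pos-* d d)))))
  where
  instance
    d*d≢0 : ℕ.NonZero (d ℕ.* d)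
    d*d≢0 = ℕ.m*n≢0 d d
  identity : ∀ z w d → (z * d + w * d) * d ≡ (z + w) * (d * d)
  identity = solve-∀

/-scaled-sub : ∀ z w c d .{{_ : ℕ.NonZero c}} .{{_ : ℕ.NonZero d}} →
               (z / (c ℕ.* d)) {{ℕ.m*n≢0 c d}} ℚ.- w / d ≡ ((z - + c * w) / (c ℕ.* d)) {{ℕ.m*n≢0 c d}}
/-scaled-sub z w c d = begin
  z / (c ℕ.* d) ℚ.+ ℚ.- (w / d)                         ≡⟨ cong (z / (c ℕ.* d) ℚ.+_) (-‿/ w d) ⟩
  z / (c ℕ.* d) ℚ.+ (- w) / d                           ≡⟨ /-+-/ z (- w) (c ℕ.* d) d ⟩
  (z * + d + - w * + (c ℕ.* d)) / (c ℕ.* d ℕ.* d)       ≡⟨ /-cross (z * + d + - w * + (c ℕ.* d)) (z - + c * w) (c ℕ.* d ℕ.* d) (c ℕ.* d) cross ⟩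
  (z - + c * w) / (c ℕ.* d)                             ∎
  where
  open ≡-Reasoning
  instance
    c*d≢0 : ℕ.NonZero (c ℕ.* d)
    c*d≢0 = ℕ.m*n≢0 c d
    c*d*d≢0 : ℕ.NonZero (c ℕ.* d ℕ.* d)
    c*d*d≢0 = ℕ.m*n≢0 (c ℕ.* d) d
  identity : ∀ z w c d → (z * d + - w * (c * d)) * (c * d) ≡ (z - c * w) * (c * d * d)
  identity = solve-∀
  cross : (z * + d + - w * + (c ℕ.* d)) * + (c ℕ.* d) ≡ (z - + c * w) * + (c ℕ.* d ℕ.* d)
  cross = begin
    (z * + d + - w * + (c ℕ.* d)) * + (c ℕ.* d)  ≡⟨ cong (λ cd → (z * + d + - w * cd) * cd) (ℤ.pos-* c d) ⟩
    (z * + d + - w * (+ c * + d)) * (+ c * + d)  ≡⟨ identity z w (+ c) (+ d) ⟩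
    (z - + c * w) * (+ c * + d * + d)            ≡⟨ cong (λ cdd → (z - + c * w) * cdd) (trans (ℤ.pos-* (c ℕ.* d) d) (cong (_* + d) (ℤ.pos-* c d))) ⟨
    (z - + c * w) * + (c ℕ.* d ℕ.* d)            ∎

/ℕ-unique : ∀ n d q r .{{_ : ℕ.NonZero d}} → r < d → n ≡ q * + d + + r → n ℤ./ℕ d ≡ q
/ℕ-unique n d q r r<d n≡qd+r = ℤ.≤-antisym (bound (ℤ.[n/ℕd]*d≤n n d) n<[q+1]d) (bound qd≤n (ℤ.n<s[n/ℕd]*d n d))
  where
  bound : ∀ {a b} → a * + d ℤ.≤ n → n ℤ.< ℤ.suc b * + d → a ℤ.≤ b
  bound {a} {b} ad≤n n<[b+1]d with a ℤ.≤? b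
  ... | yes a≤b = a≤b
  ... | no  a≰b = ⊥-elim (ℤ.<-irrefl refl (ℤ.<-≤-trans n<[b+1]d (ℤ.≤-trans [b+1]d≤ad ad≤n)))
    where [b+1]d≤ad : ℤ.suc b * + d ℤ.≤ a * + d
          [b+1]d≤ad = ℤ.*-monoʳ-≤-nonNeg (+ d) (ℤ.i<j⇒suc[i]≤j (ℤ.≰⇒> a≰b))
  qd≤n : q * + d ℤ.≤ n
  qd≤n = subst (q * + d ℤ.≤_) (sym n≡qd+r) (ℤ.i≤i+j (q * + d) (+ r))
  n<[q+1]d : n ℤ.< ℤ.suc q * + d
  n<[q+1]d = subst₂ ℤ._<_ (sym n≡qd+r) (trans (ℤ.+-comm (q * + d) (+ d)) (sym (ℤ.suc-* q (+ d))))
                    (ℤ.+-monoʳ-< (q * + d) (ℤ.+<+ r<d))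

i*[1+g]≡+r⇒i≡+r′ : ∀ R g r → R * + suc g ≡ + r → Σ ℕ λ r′ → R ≡ + r′ × r′ ℕ.* suc g ≡ r
i*[1+g]≡+r⇒i≡+r′ (+ r′) g r eq = r′ , refl , ℤ.+-injective (trans (ℤ.pos-* r′ (suc g)) eq)

floor-scaled : ∀ x {z d q r} g → r < d → z ≡ q * + d + + r →
                  ↥ x * + suc g ≡ z → ↧ x * + suc g ≡ + d → floor x ≡ q
floor-scaled x@record{} {z} {d} {q} {r} g r<d z≡qd+r ↥x*g≡z ↧x*g≡d =
  remainder (i*[1+g]≡+r⇒i≡+r′ (↥ x - q * ↧ x) g r R*g≡r)
  where
  R*g≡r : (↥ x - q * ↧ x) * + suc g ≡ + r
  R*g≡r = begin
    (↥ x - q * ↧ x) * + suc g             ≡⟨ identity (↥ x) (↧ x) q (+ suc g) ⟩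
    ↥ x * + suc g - q * (↧ x * + suc g)   ≡⟨ cong₂ (λ a b → a - q * b) ↥x*g≡z ↧x*g≡d ⟩
    z - q * + d                           ≡⟨ cong (_- q * + d) z≡qd+r ⟩
    q * + d + + r - q * + d               ≡⟨ identity′ (q * + d) (+ r) ⟩
    + r                                   ∎
    where
    open ≡-Reasoning
    identity : ∀ n m q g → (n - q * m) * g ≡ n * g - q * (m * g)
    identity = solve-∀
    identity′ : ∀ a b → a + b - a ≡ b
    identity′ = solve-∀
  remainder : Σ ℕ (λ r′ → ↥ x - q * ↧ x ≡ + r′ × r′ ℕ.* suc g ≡ r) → floor x ≡ q
  remainder (r′ , R≡r′ , r′*g≡r) = trans (ℤ.div-pos-is-/ℕ (↥ x) (↧ₙ x)) (/ℕ-unique (↥ x) (↧ₙ x) q r′ r′<↧x ↥x≡q↧x+r′)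
    where
    r′<↧x : r′ < ↧ₙ x
    r′<↧x = ℕ.*-cancelʳ-< (suc g) r′ (↧ₙ x)
      (subst₂ _<_ (sym r′*g≡r) (sym (ℤ.+-injective (trans (ℤ.pos-* (↧ₙ x) (suc g)) ↧x*g≡d))) r<d)
    ↥x≡q↧x+r′ : ↥ x ≡ q * ↧ x + + r′
    ↥x≡q↧x+r′ = trans (identity (↥ x) (q * ↧ x)) (cong (_+_ (q * ↧ x)) R≡r′)
      where identity : ∀ n m → n ≡ m + (n - m)
            identity = solve-∀

floor-/ : ∀ z d q r .{{_ : ℕ.NonZero d}} → r < d → z ≡ q * + d + + r → floor (z / d) ≡ q
floor-/ z d q r r<d z≡qd+r with ℕ.gcd ∣ z ∣ d | ℕ.gcd[m,n]≢0 ∣ z ∣ d (inj₂ (ℕ.≢-nonZero⁻¹ d)) | ℚ.↥-/ z d | ℚ.↧-/ z d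
... | suc g | _ | ↥*g≡z | ↧*g≡d = floor-scaled (z / d) g r<d z≡qd+r ↥*g≡z ↧*g≡d
... | zero  | g≢0 | _ | _ = ⊥-elim (g≢0 refl)

frac-/ : ∀ z d q r .{{_ : ℕ.NonZero d}} → r < d → z ≡ q * + d + + r → frac (z / d) ≡ + r / d
frac-/ z d q r r<d z≡qd+r = begin
  z / d ℚ.- floor (z / d) / 1      ≡⟨ cong (λ f → z / d ℚ.- f / 1) (floor-/ z d q r r<d z≡qd+r) ⟩
  z / d ℚ.+ ℚ.- (q / 1)            ≡⟨ cong (z / d ℚ.+_) (-‿/ q 1) ⟩
  z / d ℚ.+ (- q) / 1              ≡⟨ /-+-/ z (- q) d 1 ⟩
  (z * 1ℤ + - q * + d) / (d ℕ.* 1) ≡⟨ /-cross (z * 1ℤ + - q * + d) (+ r) (d ℕ.* 1) d (cong₂ _*_ eq (cong +_ (sym (ℕ.*-identityʳ d)))) ⟩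
  + r / d                          ∎
  where
  open ≡-Reasoning
  instance
    d*1≢0 : ℕ.NonZero (d ℕ.* 1)
    d*1≢0 = ℕ.m*n≢0 d 1
  eq : z * 1ℤ + - q * + d ≡ + r
  eq = trans (cong (λ z → z * 1ℤ + - q * + d) z≡qd+r) (identity q (+ d) (+ r))
    where identity : ∀ q d r → (q * d + r) * 1ℤ + - q * d ≡ r
          identity = solve-∀

frac-periodic : ∀ z d .{{_ : ℕ.NonZero d}} → frac ((z + + d) / d) ≡ frac (z / d)
frac-periodic z d = trans (frac-/ (z + + d) d (q + 1ℤ) r r<d (trans (cong (_+ + d) z≡) (identity (+ r) q (+ d))))
                          (sym (frac-/ z d q r r<d (trans z≡ (ℤ.+-comm (+ r) (q * + d)))))
  where
  q : ℤ
  q = z ℤ./ℕ d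
  r : ℕ
  r = z ℤ.%ℕ d
  r<d : r < d
  r<d = ℤ.n%ℕd<d z d
  z≡ : z ≡ + r + q * + d
  z≡ = ℤ.a≡a%ℕn+[a/ℕn]*n z d
  identity : ∀ r q d → r + q * d + d ≡ (q + 1ℤ) * d + r
  identity = solve-∀

m-n≡+[m∸n] : ∀ {x y} → y ≤ x → + x - + y ≡ + (x ∸ y)
m-n≡+[m∸n] {x} {y} y≤x = trans (ℤ.m-n≡m⊖n x y) (ℤ.⊖-≥ y≤x)

d+x∸y<d : ∀ {x y d} .{{_ : ℕ.NonZero d}} → x < y → d ℕ.+ x ∸ y < d
d+x∸y<d {x} {y} {d} x<y = ℕ.m<n+o⇒m∸n<o (d ℕ.+ x) y (subst (d ℕ.+ x <_) (ℕ.+-comm d y) (ℕ.+-monoʳ-< d x<y))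

x-y≡-d+[d+x∸y] : ∀ {x y d} → y ≤ d → + x - + y ≡ -1ℤ * + d + + (d ℕ.+ x ∸ y)
x-y≡-d+[d+x∸y] {x} {y} {d} y≤d = begin
  + x - + y                      ≡⟨ identity (+ d) (+ x) (+ y) ⟩
  -1ℤ * + d + (+ d + + x - + y)   ≡⟨ cong (λ z → -1ℤ * + d + (z - + y)) (ℤ.pos-+ d x) ⟨
  -1ℤ * + d + (+ (d ℕ.+ x) - + y) ≡⟨ cong (_+_ (-1ℤ * + d)) (m-n≡+[m∸n] (ℕ.≤-trans y≤d (ℕ.m≤m+n d x))) ⟩
  -1ℤ * + d + + (d ℕ.+ x ∸ y)     ∎
  where
  open ≡-Reasoning
  identity : ∀ d x y → x - y ≡ -1ℤ * d + (d + x - y)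
  identity = solve-∀

floor-small : ∀ {x d} .{{_ : ℕ.NonZero d}} → x < d → floor (+ x / d) ≡ 0ℤ
floor-small {x} {d} x<d = floor-/ (+ x) d 0ℤ x x<d refl

frac-small : ∀ {x d} .{{_ : ℕ.NonZero d}} → x < d → frac (+ x / d) ≡ + x / d
frac-small {x} {d} x<d = frac-/ (+ x) d 0ℤ x x<d refl

floor-one : ∀ {x d} .{{_ : ℕ.NonZero d}} → d ≤ x → x < d ℕ.+ d → floor (+ x / d) ≡ 1ℤ
floor-one {x} {d} d≤x x<2d = floor-/ (+ x) d 1ℤ (x ∸ d) (ℕ.+-cancelˡ-< d _ _ (subst (_< d ℕ.+ d) (sym (ℕ.m+[n∸m]≡n d≤x)) x<2d))
  (trans (cong +_ (sym (ℕ.m+[n∸m]≡n d≤x))) (trans (ℤ.pos-+ d (x ∸ d)) (cong (_+ + (x ∸ d)) (sym (ℤ.*-identityˡ (+ d))))))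

floor-diff-≥ : ∀ {x y d} .{{_ : ℕ.NonZero d}} → y ≤ x → x < d → floor ((+ x - + y) / d) ≡ 0ℤ
floor-diff-≥ {x} {y} {d} y≤x x<d = floor-/ (+ x - + y) d 0ℤ (x ∸ y) (ℕ.≤-<-trans (ℕ.m∸n≤m x y) x<d) (m-n≡+[m∸n] y≤x)

floor-diff-< : ∀ {x y d} .{{_ : ℕ.NonZero d}} → x < y → y ≤ d → floor ((+ x - + y) / d) ≡ -1ℤ
floor-diff-< {x} {y} {d} x<y y≤d = floor-/ (+ x - + y) d -1ℤ (d ℕ.+ x ∸ y) (d+x∸y<d x<y) (x-y≡-d+[d+x∸y] y≤d)

frac-neg : ∀ {y d} .{{_ : ℕ.NonZero d}} → 0 < y → y ≤ d → frac ((- + y) / d) ≡ + (d ∸ y) / d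
frac-neg {y} {d} 0<y y≤d = frac-/ (- + y) d -1ℤ (d ∸ y) (ℕ.∸-monoʳ-< 0<y y≤d)
  (trans (identity (+ d) (+ y)) (cong (_+_ (-1ℤ * + d)) (m-n≡+[m∸n] y≤d)))
  where identity : ∀ d y → - y ≡ -1ℤ * d + (d - y)
        identity = solve-∀

-- The parameters of ₚ₋₁Gₚ₋₁

module HypergeometricParameters (n : ℕ) where

  N : ℕ
  N = suc n

  α β s : ℕ → ℚ
  α k = + (1 ℕ.+ 2 ℕ.* k) / (2 ℕ.* N)
  β k = + k / N
  s a = + a / N

  α-s≡ : ∀ k a → α k ℚ.- s a ≡ (+ (1 ℕ.+ 2 ℕ.* k) - + (2 ℕ.* a)) / (2 ℕ.* N)
  α-s≡ k a = trans (/-scaled-sub (+ (1 ℕ.+ 2 ℕ.* k)) (+ a) 2 N)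
                   (cong (λ y → (+ (1 ℕ.+ 2 ℕ.* k) - y) / (2 ℕ.* N)) (sym (ℤ.pos-* 2 a)))

  -β+s≡ : ∀ k a → ℚ.- β k ℚ.+ s a ≡ (+ a - + k) / N
  -β+s≡ k a = begin
    ℚ.- (+ k / N) ℚ.+ + a / N   ≡⟨ cong (ℚ._+ + a / N) (-‿/ (+ k) N) ⟩
    (- + k) / N ℚ.+ + a / N     ≡⟨ /-+-same (- + k) (+ a) N ⟩
    (- + k + + a) / N           ≡⟨ cong (_/ N) (ℤ.+-comm (- + k) (+ a)) ⟩
    (+ a - + k) / N             ∎
    where open ≡-Reasoning

  ∏-frac-α-shift : ∀ (G : ℚ → ℤ) a → ∏[ k < N ] G (frac (α k ℚ.- s a)) ≡ ∏[ k < N ] G (frac (α k))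
  ∏-frac-α-shift G a = begin
    ∏[ k < N ] G (frac (α k ℚ.- s a))        ≡⟨ ∏-cong N (λ k _ → cong (G ∘ frac) (trans (α-s≡ k a) (cong (_/ (2 ℕ.* N)) (numerator k)))) ⟩
    ∏[ k < N ] g (1ℤ + + 2 * (+ k - + a))    ≡⟨ ∏-periodic-shift n g 1ℤ (+ 2) periodic a ⟩
    ∏[ k < N ] g (1ℤ + + 2 * + k)            ≡⟨ ∏-cong N (λ k _ → cong (λ y → g (1ℤ + y)) (ℤ.pos-* 2 k)) ⟨
    ∏[ k < N ] G (frac (α k))                ∎
    where
    open ≡-Reasoning
    g : ℤ → ℤ
    g x = G (frac (x / (2 ℕ.* N)))
    periodic : ∀ x → g (x + + 2 * + N) ≡ g x
    periodic x = cong G (trans (cong (λ y → frac ((x + y) / (2 ℕ.* N))) (ℤ.pos-* 2 N)) (frac-periodic x (2 ℕ.* N)))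
    numerator : ∀ k → + (1 ℕ.+ 2 ℕ.* k) - + (2 ℕ.* a) ≡ 1ℤ + + 2 * (+ k - + a)
    numerator k = trans (cong₂ (λ x y → 1ℤ + x - y) (ℤ.pos-* 2 k) (ℤ.pos-* 2 a)) (identity (+ k) (+ a))
      where identity : ∀ k a → 1ℤ + + 2 * k - + 2 * a ≡ 1ℤ + + 2 * (k - a)
            identity = solve-∀

  ∏-frac-β-shift : ∀ (G : ℚ → ℤ) a → ∏[ k < N ] G (frac (ℚ.- β k ℚ.+ s a)) ≡ ∏[ k < N ] G (frac (ℚ.- β k))
  ∏-frac-β-shift G a = begin
    ∏[ k < N ] G (frac (ℚ.- β k ℚ.+ s a))     ≡⟨ ∏-cong N (λ k _ → cong (G ∘ frac) (trans (-β+s≡ k a) (cong (_/ N) (identity₁ (+ k) (+ a))))) ⟩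
    ∏[ k < N ] g (0ℤ + -1ℤ * (+ k - + a))    ≡⟨ ∏-periodic-shift n g 0ℤ -1ℤ periodic a ⟩
    ∏[ k < N ] g (0ℤ + -1ℤ * + k)            ≡⟨ ∏-cong N (λ k _ → cong (G ∘ frac) (trans (-‿/ (+ k) N) (cong (_/ N) (identity₂ (+ k))))) ⟨
    ∏[ k < N ] G (frac (ℚ.- β k))            ∎
    where
    open ≡-Reasoning
    g : ℤ → ℤ
    g x = G (frac (x / N))
    periodic : ∀ x → g (x + -1ℤ * + N) ≡ g x
    periodic x = cong G (trans (sym (frac-periodic (x + -1ℤ * + N) N)) (cong (λ y → frac (y / N)) (identity (+ N) x)))
      where identity : ∀ N x → x + -1ℤ * N + N ≡ x
            identity = solve-∀
    identity₁ : ∀ k a → a - k ≡ 0ℤ + -1ℤ * (k - a)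
    identity₁ = solve-∀
    identity₂ : ∀ k → - k ≡ 0ℤ + -1ℤ * k
    identity₂ = solve-∀

  1+2k<2N : ∀ {k} → k < N → 1 ℕ.+ 2 ℕ.* k < 2 ℕ.* N
  1+2k<2N {k} k<N = subst (ℕ._≤ 2 ℕ.* N) (ℕ.*-suc 2 k) (ℕ.*-monoʳ-≤ 2 k<N)

  ⌊α-s⌋≡0 : ∀ {k a} → a ≤ k → k < N → floor (frac (α k) ℚ.- s a) ≡ 0ℤ
  ⌊α-s⌋≡0 {k} {a} a≤k k<N = begin
    floor (frac (α k) ℚ.- s a)   ≡⟨ cong (λ x → floor (x ℚ.- s a)) (frac-small (1+2k<2N k<N)) ⟩
    floor (α k ℚ.- s a)          ≡⟨ cong floor (α-s≡ k a) ⟩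
    floor ((+ (1 ℕ.+ 2 ℕ.* k) - + (2 ℕ.* a)) / (2 ℕ.* N))
                                 ≡⟨ floor-diff-≥ (ℕ.≤-trans (ℕ.*-monoʳ-≤ 2 a≤k) (ℕ.n≤1+n _)) (1+2k<2N k<N) ⟩
    0ℤ                           ∎
    where open ≡-Reasoning

  ⌊α-s⌋≡-1 : ∀ {k a} → k < a → a < N → floor (frac (α k) ℚ.- s a) ≡ -1ℤ
  ⌊α-s⌋≡-1 {k} {a} k<a a<N = begin
    floor (frac (α k) ℚ.- s a)   ≡⟨ cong (λ x → floor (x ℚ.- s a)) (frac-small (1+2k<2N (ℕ.<-trans k<a a<N))) ⟩
    floor (α k ℚ.- s a)          ≡⟨ cong floor (α-s≡ k a) ⟩
    floor ((+ (1 ℕ.+ 2 ℕ.* k) - + (2 ℕ.* a)) / (2 ℕ.* N))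
                                 ≡⟨ floor-diff-< (subst (ℕ._≤ 2 ℕ.* a) (ℕ.*-suc 2 k) (ℕ.*-monoʳ-≤ 2 k<a))
                                                 (ℕ.*-monoʳ-≤ 2 (ℕ.<⇒≤ a<N)) ⟩
    -1ℤ                          ∎
    where open ≡-Reasoning

  ⌊-β₀+s⌋≡0 : ∀ {a} → a < N → floor (frac (ℚ.- β 0) ℚ.+ s a) ≡ 0ℤ
  ⌊-β₀+s⌋≡0 {a} a<N = begin
    floor (frac (ℚ.- β 0) ℚ.+ s a)   ≡⟨ cong (λ x → floor (frac x ℚ.+ s a)) (-‿/ 0ℤ N) ⟩
    floor (frac (0ℤ / N) ℚ.+ s a)    ≡⟨ cong (λ x → floor (x ℚ.+ s a)) (frac-small {d = N} ℕ.z<s) ⟩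
    floor (0ℤ / N ℚ.+ + a / N)       ≡⟨ cong floor (/-+-same 0ℤ (+ a) N) ⟩
    floor (+ a / N)                  ≡⟨ floor-small a<N ⟩
    0ℤ                               ∎
    where open ≡-Reasoning

  frac-β+s≡ : ∀ {k} a → suc k ≤ N → frac (ℚ.- β (suc k)) ℚ.+ s a ≡ + (N ∸ suc k ℕ.+ a) / N
  frac-β+s≡ {k} a k<N = begin
    frac (ℚ.- β (suc k)) ℚ.+ s a     ≡⟨ cong (λ x → frac x ℚ.+ s a) (-‿/ (+ suc k) N) ⟩
    frac ((- + suc k) / N) ℚ.+ s a   ≡⟨ cong (ℚ._+ s a) (frac-neg ℕ.z<s k<N) ⟩
    + (N ∸ suc k) / N ℚ.+ + a / N    ≡⟨ /-+-same (+ (N ∸ suc k)) (+ a) N ⟩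
    + (N ∸ suc k ℕ.+ a) / N          ∎
    where open ≡-Reasoning

  ⌊-β+s⌋≡0 : ∀ {k a} → a ≤ k → suc k ≤ N → floor (frac (ℚ.- β (suc k)) ℚ.+ s a) ≡ 0ℤ
  ⌊-β+s⌋≡0 {k} {a} a≤k k<N = trans (cong floor (frac-β+s≡ a k<N))
    (floor-small (subst (N ∸ suc k ℕ.+ a <_) (ℕ.m∸n+n≡m k<N) (ℕ.+-monoʳ-< (N ∸ suc k) (s≤s a≤k))))

  ⌊-β+s⌋≡1 : ∀ {k a} → suc k ≤ a → a < N → floor (frac (ℚ.- β (suc k)) ℚ.+ s a) ≡ 1ℤ
  ⌊-β+s⌋≡1 {k} {a} k<a a<N = trans (cong floor (frac-β+s≡ a k<N))
    (floor-one (subst (_≤ N ∸ suc k ℕ.+ a) (ℕ.m∸n+n≡m k<N) (ℕ.+-monoʳ-≤ (N ∸ suc k) k<a))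
               (ℕ.+-mono-≤-< (ℕ.m∸n≤m N (suc k)) a<N))
    where k<N : suc k ≤ N
          k<N = ℕ.≤-trans k<a (ℕ.<⇒≤ a<N)

  e : ℕ → ℕ → ℤ
  e k a = - floor (frac (α k) ℚ.- s a) - floor (frac (ℚ.- β k) ℚ.+ s a)

  e[0,0]≡0 : e 0 0 ≡ 0ℤ
  e[0,0]≡0 = cong₂ (λ x y → - x - y) (⌊α-s⌋≡0 z≤n ℕ.z<s) (⌊-β₀+s⌋≡0 ℕ.z<s)

  e[0,1+a]≡1 : ∀ {a} → suc a < N → e 0 (suc a) ≡ 1ℤ
  e[0,1+a]≡1 a<N = cong₂ (λ x y → - x - y) (⌊α-s⌋≡-1 ℕ.z<s a<N) (⌊-β₀+s⌋≡0 a<N)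

  e[a,a]≡-1 : ∀ {a} → suc a < N → e (suc a) (suc a) ≡ -1ℤ
  e[a,a]≡-1 a<N = cong₂ (λ x y → - x - y) (⌊α-s⌋≡0 ℕ.≤-refl a<N) (⌊-β+s⌋≡1 ℕ.≤-refl a<N)

  e-off-diagonal : ∀ {k a} → suc k < N → a < N → suc k ≢ a → e (suc k) a ≡ 0ℤ
  e-off-diagonal {k} {a} k<N a<N k≢a with ℕ.<-cmp a (suc k)
  ... | tri< a<k _ _ = cong₂ (λ x y → - x - y) (⌊α-s⌋≡0 (ℕ.<⇒≤ a<k) k<N) (⌊-β+s⌋≡0 (ℕ.≤-pred a<k) (ℕ.<⇒≤ k<N))
  ... | tri≈ _ a≡k _ = ⊥-elim (k≢a (sym a≡k))
  ... | tri> _ _ k<a = cong₂ (λ x y → - x - y) (⌊α-s⌋≡-1 k<a a<N) (⌊-β+s⌋≡1 (ℕ.<⇒≤ k<a) a<N)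

  module _ (p : ℕ) where

    -- p · (−p)^i, for i ≥ −1
    pPart : ℤ → ℤ
    pPart i = -1ℤ ^ ∣ i ∣ * (+ p) ^ ∣ 1ℤ + i ∣

    pPart[0]≡p : pPart 0ℤ ≡ + p
    pPart[0]≡p = trans (ℤ.*-identityˡ ((+ p) ^ 1)) (ℤ.^-identityʳ (+ p))

    ∏-pPart : ∀ a → a < N → ∏[ k < N ] pPart (e k a) ≡ (+ p) ^ N
    ∏-pPart zero    _   = trans (∏-cong N e[k,0]≡p) (∏-const N (+ p))
      where
      e[k,0]≡p : ∀ k → k < N → pPart (e k 0) ≡ + p
      e[k,0]≡p zero    _   = trans (cong pPart e[0,0]≡0) pPart[0]≡p
      e[k,0]≡p (suc k) k<N = trans (cong pPart (e-off-diagonal k<N ℕ.z<s λ ())) pPart[0]≡p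
    ∏-pPart (suc a) a<N = begin
      pPart (e 0 (suc a)) * ∏[ k < n ] pPart (e (suc k) (suc a))
        ≡⟨ cong₂ _*_ (cong pPart (e[0,1+a]≡1 a<N))
             (∏-single n a (λ k → pPart (e (suc k) (suc a))) (pPart -1ℤ) (+ p) (ℕ.≤-pred a<N) (cong pPart (e[a,a]≡-1 a<N))
               (λ k k<n k≢a → trans (cong pPart (e-off-diagonal (s≤s k<n) a<N (k≢a ∘ ℕ.suc-injective))) pPart[0]≡p)) ⟩
      pPart 1ℤ * (pPart -1ℤ * (+ p) ^ (n ∸ 1))
        ≡⟨ identity (+ p) ((+ p) ^ (n ∸ 1)) ⟩
      + p * (+ p * (+ p) ^ (n ∸ 1))
        ≡⟨ cong (+ p *_) (*-^-pred (+ p) (ℕ.m<n⇒0<n (ℕ.≤-pred a<N))) ⟩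
      (+ p) ^ N
        ∎
      where
      open ≡-Reasoning
      identity : ∀ p x → -1ℤ * (p * (p * 1ℤ)) * (-1ℤ * 1ℤ * x) ≡ p * (p * x)
      identity = solve-∀

sumℤ-applyUpTo : ∀ n (f : ℕ → ℤ) g → sumℤ (List.map f (List.applyUpTo g n)) ≡ ∑[ a < n ] f (g a)
sumℤ-applyUpTo zero    f g = refl
sumℤ-applyUpTo (suc n) f g = cong (_+_ (f (g 0))) (sumℤ-applyUpTo n f (g ∘ suc))

prodℤ-zipWith-tabulate : ∀ n (φ : ℚ → ℚ → ℤ) (G H : ℕ → ℚ) →
  prodℤ (Vec.toList (Vec.zipWith φ (Vec.tabulate {n = n} (G ∘ toℕ)) (Vec.tabulate (H ∘ toℕ)))) ≡ ∏[ k < n ] φ (G k) (H k)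
prodℤ-zipWith-tabulate zero    φ G H = refl
prodℤ-zipWith-tabulate (suc n) φ G H = cong (_*_ (φ (G 0) (H 0))) (prodℤ-zipWith-tabulate n φ (G ∘ suc) (H ∘ suc))

pos-^ : ∀ m n → + (m ℕ.^ n) ≡ (+ m) ^ n
pos-^ m zero    = refl
pos-^ m (suc n) = trans (ℤ.pos-* m (m ℕ.^ n)) (cong (_*_ (+ m)) (pos-^ m n))

-1^even : ∀ {m} → 2 ℕ.∣ m → -1ℤ ^ m ≡ 1ℤ
-1^even (ℕ.divides h refl) = trans (cong (-1ℤ ^_) (ℕ.*-comm h 2)) (trans (sym (ℤ.^-*-assoc -1ℤ 2 h)) (ℤ.^-zeroˡ h))

odd-prime⇒2∣p∸1 : ∀ {p} → Prime p → 3 ≤ p → 2 ℕ.∣ p ∸ 1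
odd-prime⇒2∣p∸1 {p} p-prime 3≤p with p ℕ.% 2 | ℕ.m≡m%n+[m/n]*n p 2 | ℕ.m%n<n p 2
... | 0           | p≡2h   | _ with prime⇒irreducible p-prime (ℕ.divides (p ℕ./ 2) p≡2h)
...   | inj₁ ()
...   | inj₂ 2≡p = ⊥-elim (ℕ.<⇒≢ 3≤p 2≡p)
odd-prime⇒2∣p∸1 {p} p-prime 3≤p | 1 | p≡2h+1 | _ = ℕ.divides (p ℕ./ 2) (cong (_∸ 1) p≡2h+1)
odd-prime⇒2∣p∸1 {p} p-prime 3≤p | suc (suc r) | _ | r+2<2 = ⊥-elim (ℕ.<⇒≱ r+2<2 (s≤s (s≤s z≤n)))

≈ₚ-constQp : ∀ {p} (x : Qp p) c → (∀ j → approx x (suc j) ≡ + (p ℕ.^ shift x) * c mod (p ℕ.^ suc j)) → x ≈ₚ constQp c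
≈ₚ-constQp x c approx≡ zero    = ℕ.1∣ _
≈ₚ-constQp x c approx≡ (suc j) =
  ∣⇒∣ᵤ (subst (_ ∣_) (cong (_- _) (sym (ℤ.*-identityˡ (approx x (suc j))))) (≡-mod⇒∣ (approx≡ j)))

module _ {n : ℕ} (p-prime : Prime (suc (suc n))) (2∣N : 2 ℕ.∣ suc n) where
  open HypergeometricParameters n
  private
    p : ℕ
    p = suc N

  p∤Γp : ∀ K x → ¬ + p ∣ Γp p K x
  p∤Γp K x = p∤Γnat p-prime (modℕ (p ℕ.^ K) (↥ x * invMod p K (↧ x)))

  -- factor p K a (α k) (β k) unfolds to pPart p (e k a) * ΓA k * ΓB k.
  factor-product≡pᴺ : ∀ (j : ℕ) a → a < N →
    prodℤ (Vec.toList (Vec.zipWith (factor p (suc j) a) (aParams N) (bParams N))) ≡ (+ p) ^ N mod (p ℕ.^ suc j)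
  factor-product≡pᴺ j a a<N = begin
    prodℤ (Vec.toList (Vec.zipWith (factor p K a) (aParams N) (bParams N)))
      ≡⟨ prodℤ-zipWith-tabulate N (factor p K a) α β ⟩
    ∏[ k < N ] (pPart p (e k a) * ΓA k * ΓB k)
      ≡⟨ trans (∏-distrib-* N {λ k → pPart p (e k a) * ΓA k} {ΓB}) (cong (_* ∏< N ΓB) (∏-distrib-* N {λ k → pPart p (e k a)} {ΓA})) ⟩
    ∏[ k < N ] pPart p (e k a) * ∏< N ΓA * ∏< N ΓB
      ≈⟨ *-cong-mod (*-cong-mod (≡⇒≡-mod (∏-pPart p a a<N)) ∏ΓA≡1) ∏ΓB≡1 ⟩
    (+ p) ^ N * 1ℤ * 1ℤ
      ≡⟨ trans (ℤ.*-identityʳ _) (ℤ.*-identityʳ _) ⟩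
    (+ p) ^ N
      ∎
    where
    open ≡-mod-Reasoning (p ℕ.^ suc j)
    K : ℕ
    K = suc j
    ΓA ΓB : ℕ → ℤ
    ΓA k = Γp p K (frac (α k ℚ.- s a)) * invMod p K (Γp p K (frac (α k)))
    ΓB k = Γp p K (frac (ℚ.- β k ℚ.+ s a)) * invMod p K (Γp p K (frac (ℚ.- β k)))
    ∏ΓA≡1 : ∏< N ΓA ≡ 1ℤ mod (p ℕ.^ K)
    ∏ΓA≡1 = ∏-ratio≡1 N (λ k → Γp p K (frac (α k ℚ.- s a))) (λ k → Γp p K (frac (α k))) (invMod p K) (∏-frac-α-shift (Γp p K) a)
              (λ k _ → invMod-inverse p-prime (p∤Γp K (frac (α k))) j)
    ∏ΓB≡1 : ∏< N ΓB ≡ 1ℤ mod (p ℕ.^ K)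
    ∏ΓB≡1 = ∏-ratio≡1 N (λ k → Γp p K (frac (ℚ.- β k ℚ.+ s a))) (λ k → Γp p K (frac (ℚ.- β k))) (invMod p K) (∏-frac-β-shift (Γp p K) a)
              (λ k _ → invMod-inverse p-prime (p∤Γp K (frac (ℚ.- β k))) j)

  nGnScaled≡ : ∀ (j : ℕ) t → nGnScaled p N (aParams N) (bParams N) t (suc j)
                       ≡ - invMod p (suc j) (+ N) * (∑[ a < N ] ωbarPow p (suc j) t a * (+ p) ^ N) mod (p ℕ.^ suc j)
  nGnScaled≡ j t = *-congˡ-mod (- invMod p (suc j) (+ N)) (begin
    sumℤ (List.map F (List.upTo N))             ≡⟨ sumℤ-applyUpTo N F (λ a → a) ⟩
    ∑< N F                                      ≈⟨ ∑-cong-mod N F≡ ⟩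
    ∑[ a < N ] (ωbarPow p (suc j) t a * (+ p) ^ N)  ≡⟨ ∑-*ʳ N ((+ p) ^ N) (ωbarPow p (suc j) t) ⟩
    ∑[ a < N ] ωbarPow p (suc j) t a * (+ p) ^ N    ∎)
    where
    open ≡-mod-Reasoning (p ℕ.^ suc j)
    F : ℕ → ℤ
    F a = -1ℤ ^ (a ℕ.* N) * ωbarPow p (suc j) t a
          * prodℤ (Vec.toList (Vec.zipWith (factor p (suc j) a) (aParams N) (bParams N)))
    F≡ : ∀ a → a < N → F a ≡ ωbarPow p (suc j) t a * (+ p) ^ N mod (p ℕ.^ suc j)
    F≡ a a<N = *-cong-mod (≡⇒≡-mod (trans (cong (_* ωbarPow p (suc j) t a) (-1^even (ℕ.∣n⇒∣m*n a 2∣N)))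
                                         (ℤ.*-identityˡ _)))
                          (factor-product≡pᴺ j a a<N)

  nGnScaled≡0 : ∀ (j : ℕ) t → toℕ t ≢ 1 →
                nGnScaled p N (aParams N) (bParams N) t (suc j) ≡ + (p ℕ.^ N) * 0ℤ mod (p ℕ.^ suc j)
  nGnScaled≡0 j t t≢1 = begin
    nGnScaled p N (aParams N) (bParams N) t (suc j)                   ≈⟨ nGnScaled≡ j t ⟩
    - v * (∑[ a < N ] ωbarPow p (suc j) t a * (+ p) ^ N)              ≈⟨ *-congˡ-mod (- v) (*-congʳ-mod ((+ p) ^ N) (∑ωbar≡0 p-prime j t t≢1)) ⟩
    - v * (0ℤ * (+ p) ^ N)                                            ≡⟨ trans (ℤ.*-zeroʳ (- v)) (sym (ℤ.*-zeroʳ (+ (p ℕ.^ N)))) ⟩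
    + (p ℕ.^ N) * 0ℤ                                                  ∎
    where
    open ≡-mod-Reasoning (p ℕ.^ suc j)
    v : ℤ
    v = invMod p (suc j) (+ N)

  nGnScaled≡-1 : ∀ (j : ℕ) t → toℕ t ≡ 1 →
                 nGnScaled p N (aParams N) (bParams N) t (suc j) ≡ + (p ℕ.^ N) * -1ℤ mod (p ℕ.^ suc j)
  nGnScaled≡-1 j t t≡1 = begin
    nGnScaled p N (aParams N) (bParams N) t (suc j)         ≈⟨ nGnScaled≡ j t ⟩
    - v * (∑[ a < N ] ωbarPow p (suc j) t a * (+ p) ^ N)    ≡⟨ cong (λ x → - v * (x * (+ p) ^ N)) (∑ωbar≡q p-prime j t t≡1) ⟩
    - v * (+ N * (+ p) ^ N)                                 ≡⟨ identity v (+ N) ((+ p) ^ N) ⟩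
    - (+ N * v) * (+ p) ^ N                                 ≈⟨ *-congʳ-mod ((+ p) ^ N) (-‿cong-mod (invMod-inverse p-prime p∤N j)) ⟩
    - 1ℤ * (+ p) ^ N                                        ≡⟨ trans (cong (_* -1ℤ) (pos-^ p N)) (ℤ.*-comm ((+ p) ^ N) -1ℤ) ⟨
    + (p ℕ.^ N) * -1ℤ                                       ∎
    where
    open ≡-mod-Reasoning (p ℕ.^ suc j)
    v : ℤ
    v = invMod p (suc j) (+ N)
    identity : ∀ v n x → - v * (n * x) ≡ - (n * v) * x
    identity = solve-∀
    p∤N : ¬ + p ∣ + N
    p∤N p∣N = ℕ.<⇒≱ (ℕ.n<1+n N) (ℕ.∣⇒≤ (∣⇒∣ᵤ p∣N))

corollary2p7 : (p : ℕ) → Prime p → 3 ≤ p →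
    ((t : Fin p) → toℕ t ≢ 1 → nG p (p ∸ 1) t ≈ₚ constQp (+ 0))
    × ((t : Fin p) → toℕ t ≡ 1 → nG p (p ∸ 1) t ≈ₚ constQp (- (+ 1)))
corollary2p7 p p-prime 3≤p@(s≤s (s≤s (s≤s _))) =
    (λ t t≢1 → ≈ₚ-constQp (nG p (p ∸ 1) t) (+ 0) λ j → nGnScaled≡0 p-prime 2∣p∸1 j t t≢1)
  , (λ t t≡1 → ≈ₚ-constQp (nG p (p ∸ 1) t) (- (+ 1)) λ j → nGnScaled≡-1 p-prime 2∣p∸1 j t t≡1)
  where 2∣p∸1 : 2 ℕ.∣ p ∸ 1
        2∣p∸1 = odd-prime⇒2∣p∸1 p-prime 3≤p
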